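{- $D^s_f(Q_4;Q_1)\le 5$.
   Context: The $4$-dimensional hypercube $Q_4$ is the graph whose vertices are the binary strings of length $4$, two vertices being adjacent iff they differ in exactly one position; $Q_1\cong K_2$. The diameter of a graph is the maximum graph distance between two of its vertices. For a graph $G$ and a graph $W$, a $W$-substructure in $G$ is a subgraph of $G$ isomorphic to a connected subgraph of $W$; removing a family of subgraphs means deleting all their vertices. $\kappa^s(G;W)$ is the minimum number $t$ such that there exist $t$ pairwise vertex-disjoint $W$-substructures whose removal disconnects $G$. $D^s_f(G;W)$ is the maximum diameter of a graph obtained from $G$ by removing at most $\kappa^s(G;W)-1$ pairwise vertex-disjoint $W$-substructures. -}

module Defs where

open import Data.Bool using (Bool; true; false; _≟_)
open import Data.Nat using (ℕ; zero; suc; _≤_; _∸_)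
open import Data.Vec using (Vec; []; _∷_)
open import Data.List using (List; length)
open import Data.List.Relation.Unary.Any using (Any)
open import Data.List.Relation.Unary.AllPairs using (AllPairs)
open import Data.Product using (Σ; _×_; ∃; ∃-syntax)
open import Data.Sum using (_⊎_)
open import Data.Empty using (⊥)
open import Relation.Nullary using (¬_; yes; no)
open import Relation.Binary.PropositionalEquality using (_≡_)

hamming : ∀ {n} → Vec Bool n → Vec Bool n → ℕ
hamming [] [] = zero
hamming (x ∷ xs) (y ∷ ys) with x ≟ y
... | yes _ = hamming xs ys
... | no  _ = suc (hamming xs ys)

QV : ℕ → Set
QV n = Vec Bool n

QAdj : ∀ {n} → QV n → QV n → Set
QAdj u v = hamming u v ≡ 1

module _ {V : Set} (Adj : V → V → Set) where

  -- Q_1-substructures of G: subgraphs isomorphic to a connected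
  -- subgraph of Q_1 ≅ K_2, i.e. a single vertex (K_1) or an edge (K_2).
  data Q1Sub : Set where
    vertexSub : V → Q1Sub
    edgeSub   : (u w : V) → Adj u w → Q1Sub

  _∈Sub_ : V → Q1Sub → Set
  v ∈Sub vertexSub u     = v ≡ u
  v ∈Sub edgeSub u w _   = v ≡ u ⊎ v ≡ w

  VertexDisjoint : Q1Sub → Q1Sub → Set
  VertexDisjoint s t = ∀ v → v ∈Sub s → v ∈Sub t → ⊥

  record Family : Set where
    field
      subs     : List Q1Sub
      disjoint : AllPairs VertexDisjoint subs

  open Family public

  size : Family → ℕ
  size F = length (subs F)

  Removed : Family → V → Set
  Removed F v = Any (v ∈Sub_) (subs F)

  data WalkAvoid (F : Family) : V → V → ℕ → Set where
    here : ∀ {v} → ¬ Removed F v → WalkAvoid F v v zero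
    step : ∀ {u w v k} → ¬ Removed F u → Adj u w →
           WalkAvoid F w v k → WalkAvoid F u v (suc k)

  Disconnects : Family → Set
  Disconnects F = Σ V λ u → Σ V λ v →
    ¬ Removed F u × ¬ Removed F v × (∀ k → ¬ WalkAvoid F u v k)

  IsKappaS : ℕ → Set
  IsKappaS k = (∃[ F ] (size F ≡ k × Disconnects F))
             × (∀ F → Disconnects F → k ≤ size F)

  DiamAfterRemoval≤ : Family → ℕ → Set
  DiamAfterRemoval≤ F d = ∀ u v → ¬ Removed F u → ¬ Removed F v →
    ∃[ k ] (k ≤ d × WalkAvoid F u v k)

  DsfQ1≤ : ℕ → Set
  DsfQ1≤ d = ∀ κ → IsKappaS κ → ∀ (F : Family) → size F ≤ κ ∸ 1 →
    DiamAfterRemoval≤ F d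

-- Deleting the three edges {e_j, e_0 + e_j} (j = 1, 2, 3) cuts the edge {0, e_0} off from the rest
-- of Q_4, so κ^s(Q_4; Q_1) ≤ 3 and only families of at most two substructures matter.  Such a family
-- deletes the union of the vertex sets of at most two of the 16 vertices and 32 edges of Q_4, and
-- for each of these finitely many unions a breadth-first search from every surviving vertex
-- reaches every other surviving vertex within 5 steps.

module Submission where

open import Data.Bool using (Bool; true; false; not; _∧_; _∨_; T)
open import Data.Bool.ListAction using (all)
open import Data.Bool.Properties using (_≟_; T-≡; T-∧; T-∨; T-not-≡; ¬-not; not-involutive; ∨-comm)
open import Data.Empty using (⊥-elim)
open import Data.Fin using (Fin; zero; suc)
open import Data.List using (List; []; _∷_; map; _++_; concatMap; foldr; allFin; length; filter; cartesianProduct)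
open import Data.List.Membership.Propositional using (_∈_; lose)
open import Data.List.Membership.Propositional.Properties
  using (∈-map⁺; ∈-++⁺ˡ; ∈-++⁺ʳ; ∈-concatMap⁺; ∈-filter⁺; ∈-cartesianProduct⁺; ∈-allFin)
open import Data.List.Relation.Unary.All using (All; []; _∷_)
open import Data.List.Relation.Unary.AllPairs using ([]; _∷_)
import Data.List.Relation.Unary.All as All
open import Data.List.Relation.Unary.All.Properties using (all⁺)
open import Data.List.Relation.Unary.Any using (Any; here; there)
open import Data.Nat using (ℕ; zero; suc; _≤_; z≤n; s≤s)
open import Data.Nat.Properties using (≤-trans; ∸-monoˡ-≤; m≤n⇒m≤1+n; suc-injective)
open import Data.Product using (_×_; _,_; ∃-syntax)
import Data.Product as Product
open import Data.Sum using (_⊎_; inj₁; inj₂)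
open import Data.Sum.Function.Propositional using (_⊎-⇔_)
open import Data.Vec using ([]; _∷_; lookup; _[_]%=_)
open import Data.Vec.Properties using (lookup∘updateAt; updateAt-updateAt; updateAt-id-local)
open import Function using (_⇔_; mk⇔; Equivalence; _∘_)
open Equivalence using (to; from)
import Function.Properties.Equivalence as ⇔
open import Relation.Nullary using (¬_; yes; no)
open import Relation.Binary.PropositionalEquality
  using (_≡_; refl; sym; trans; cong; cong₂; subst)

open import Defs

private
  variable
    n : ℕ

flip : Fin n → QV n → QV n
flip i u = u [ i ]%= not

hamming-refl : (u : QV n) → hamming u u ≡ 0
hamming-refl []          = refl
hamming-refl (false ∷ u) = hamming-refl u
hamming-refl (true ∷ u)  = hamming-refl u

hamming≡0⇒≡ : (u w : QV n) → hamming u w ≡ 0 → u ≡ w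
hamming≡0⇒≡ []      []      _ = refl
hamming≡0⇒≡ (x ∷ u) (y ∷ w) h with x ≟ y
... | yes refl = cong (x ∷_) (hamming≡0⇒≡ u w h)

QAdj-flip : (i : Fin n) (u : QV n) → QAdj u (flip i u)
QAdj-flip zero    (false ∷ u) = cong suc (hamming-refl u)
QAdj-flip zero    (true ∷ u)  = cong suc (hamming-refl u)
QAdj-flip (suc i) (false ∷ u) = QAdj-flip i u
QAdj-flip (suc i) (true ∷ u)  = QAdj-flip i u

QAdj⇒flip : (u w : QV n) → QAdj u w → ∃[ i ] w ≡ flip i u
QAdj⇒flip []      []      ()
QAdj⇒flip (x ∷ u) (y ∷ w) h with x ≟ y
... | yes refl = Product.map suc (cong (x ∷_)) (QAdj⇒flip u w h)
... | no x≢y   = zero , cong₂ _∷_ (¬-not (x≢y ∘ sym)) (sym (hamming≡0⇒≡ u w (suc-injective h)))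

flip-involutive : (i : Fin n) (u : QV n) → flip i (flip i u) ≡ u
flip-involutive i u = trans (updateAt-updateAt i u) (updateAt-id-local i u (not-involutive (lookup u i)))

-- Sets of vertices of Q_n, as binary tries indexed by the bits of a vertex.
VSet : ℕ → Set
VSet zero    = Bool
VSet (suc n) = VSet n × VSet n

infix 7 _∈ᵇ_
_∈ᵇ_ : QV n → VSet n → Bool
[]          ∈ᵇ b       = b
(false ∷ x) ∈ᵇ (A , _) = x ∈ᵇ A
(true ∷ x)  ∈ᵇ (_ , A) = x ∈ᵇ A

∅ : VSet n
∅ {zero}  = false
∅ {suc n} = ∅ , ∅

⁅_⁆ : QV n → VSet n
⁅ [] ⁆        = true
⁅ false ∷ u ⁆ = ⁅ u ⁆ , ∅
⁅ true ∷ u ⁆  = ∅ , ⁅ u ⁆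

pointwise : (Bool → Bool → Bool) → VSet n → VSet n → VSet n
pointwise {zero}  f a         b         = f a b
pointwise {suc n} f (A₀ , A₁) (B₀ , B₁) = pointwise f A₀ B₀ , pointwise f A₁ B₁

infixl 8 _∪_ _∩_ _∖_
_∪_ _∩_ _∖_ : VSet n → VSet n → VSet n
_∪_ = pointwise _∨_
_∩_ = pointwise _∧_
_∖_ = pointwise (λ a b → a ∧ not b)

neighbours : VSet n → VSet n
neighbours {zero}  _         = false
neighbours {suc n} (A₀ , A₁) = neighbours A₀ ∪ A₁ , neighbours A₁ ∪ A₀

vertices : List (QV n)
vertices {zero}  = [] ∷ []
vertices {suc n} = map (false ∷_) vertices ++ map (true ∷_) vertices

isFull : VSet n → Bool
isFull A = all (_∈ᵇ A) vertices

∈-vertices : (u : QV n) → u ∈ vertices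
∈-vertices []          = here refl
∈-vertices (false ∷ u) = ∈-++⁺ˡ (∈-map⁺ (false ∷_) (∈-vertices u))
∈-vertices (true ∷ u)  = ∈-++⁺ʳ _ (∈-map⁺ (true ∷_) (∈-vertices u))

T-all-vertices : (p : QV n → Bool) → T (all p vertices) → ∀ u → T (p u)
T-all-vertices p h u = All.lookup (all⁺ p vertices h) (∈-vertices u)

∉ᵇ-∅ : (x : QV n) → ¬ T (x ∈ᵇ ∅)
∉ᵇ-∅ []          ()
∉ᵇ-∅ (false ∷ x) = ∉ᵇ-∅ x
∉ᵇ-∅ (true ∷ x)  = ∉ᵇ-∅ x

∈ᵇ-⁅⁆ : (x u : QV n) → T (x ∈ᵇ ⁅ u ⁆) ⇔ x ≡ u
∈ᵇ-⁅⁆ x u = mk⇔ (sound x u) λ { refl → complete x }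
  where
  sound : (x u : QV n) → T (x ∈ᵇ ⁅ u ⁆) → x ≡ u
  sound []          []          _ = refl
  sound (false ∷ x) (false ∷ u) h = cong (false ∷_) (sound x u h)
  sound (true ∷ x)  (true ∷ u)  h = cong (true ∷_) (sound x u h)
  sound (false ∷ x) (true ∷ u)  h = ⊥-elim (∉ᵇ-∅ x h)
  sound (true ∷ x)  (false ∷ u) h = ⊥-elim (∉ᵇ-∅ x h)
  complete : (x : QV n) → T (x ∈ᵇ ⁅ x ⁆)
  complete []          = _
  complete (false ∷ x) = complete x
  complete (true ∷ x)  = complete x

∈ᵇ-pointwise : ∀ f (x : QV n) A B → (x ∈ᵇ pointwise f A B) ≡ f (x ∈ᵇ A) (x ∈ᵇ B)
∈ᵇ-pointwise f []          A B = refl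
∈ᵇ-pointwise f (false ∷ x) A B = ∈ᵇ-pointwise f x _ _
∈ᵇ-pointwise f (true ∷ x)  A B = ∈ᵇ-pointwise f x _ _

∈ᵇ-∪ : ∀ (x : QV n) {A B} → T (x ∈ᵇ A ∪ B) ⇔ (T (x ∈ᵇ A) ⊎ T (x ∈ᵇ B))
∈ᵇ-∪ x {A} {B} rewrite ∈ᵇ-pointwise _∨_ x A B = T-∨

∈ᵇ-∩ : ∀ (x : QV n) {A B} → T (x ∈ᵇ A ∩ B) ⇔ (T (x ∈ᵇ A) × T (x ∈ᵇ B))
∈ᵇ-∩ x {A} {B} rewrite ∈ᵇ-pointwise _∧_ x A B = T-∧

∈ᵇ-∖ : ∀ (x : QV n) {A B} → T (x ∈ᵇ A ∖ B) → T (x ∈ᵇ A) × ¬ T (x ∈ᵇ B)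
∈ᵇ-∖ x {A} {B} h rewrite ∈ᵇ-pointwise (λ a b → a ∧ not b) x A B
  with to T-∧ h
... | x∈A , x∉B = x∈A , λ x∈B → subst T (to T-not-≡ x∉B) x∈B

∪-comm : (A B : VSet n) → A ∪ B ≡ B ∪ A
∪-comm {zero}  a         b         = ∨-comm a b
∪-comm {suc n} (A₀ , A₁) (B₀ , B₁) = cong₂ _,_ (∪-comm A₀ B₀) (∪-comm A₁ B₁)

∈ᵇ-neighbours : (x : QV n) (A : VSet n) → T (x ∈ᵇ neighbours A) → ∃[ i ] T (flip i x ∈ᵇ A)
∈ᵇ-neighbours (false ∷ x) (A₀ , A₁) h with to (∈ᵇ-∪ x) h
... | inj₁ near = let i , h = ∈ᵇ-neighbours x A₀ near in suc i , h
... | inj₂ x∈A = zero , x∈A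
∈ᵇ-neighbours (true ∷ x)  (A₀ , A₁) h with to (∈ᵇ-∪ x) h
... | inj₁ near = let i , h = ∈ᵇ-neighbours x A₁ near in suc i , h
... | inj₂ x∈A = zero , x∈A

module _ {Adj : QV n → QV n → Set} where

  ⟦_⟧ : Q1Sub Adj → VSet n
  ⟦ vertexSub u ⟧    = ⁅ u ⁆
  ⟦ edgeSub u w _ ⟧  = ⁅ u ⁆ ∪ ⁅ w ⁆

  ⋃ : List (Q1Sub Adj) → VSet n
  ⋃ = foldr (λ s R → ⟦ s ⟧ ∪ R) ∅

  ∈ᵇ-⟦⟧ : ∀ x s → T (x ∈ᵇ ⟦ s ⟧) ⇔ _∈Sub_ Adj x s
  ∈ᵇ-⟦⟧ x (vertexSub u)    = ∈ᵇ-⁅⁆ x u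
  ∈ᵇ-⟦⟧ x (edgeSub u w _)  = ⇔.trans (∈ᵇ-∪ x) (∈ᵇ-⁅⁆ x u ⊎-⇔ ∈ᵇ-⁅⁆ x w)

  ∈ᵇ-⋃ : ∀ x ss → T (x ∈ᵇ ⋃ ss) ⇔ Any (_∈Sub_ Adj x) ss
  ∈ᵇ-⋃ x ss = mk⇔ (sound ss) (complete ss)
    where
    sound : ∀ ss → T (x ∈ᵇ ⋃ ss) → Any (_∈Sub_ Adj x) ss
    sound []       h = ⊥-elim (∉ᵇ-∅ x h)
    sound (s ∷ ss) h with to (∈ᵇ-∪ x) h
    ... | inj₁ x∈s  = here (to (∈ᵇ-⟦⟧ x s) x∈s)
    ... | inj₂ x∈ss = there (sound ss x∈ss)
    complete : ∀ ss → Any (_∈Sub_ Adj x) ss → T (x ∈ᵇ ⋃ ss)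
    complete (s ∷ ss) (here x∈s)   = from (∈ᵇ-∪ x) (inj₁ (from (∈ᵇ-⟦⟧ x s) x∈s))
    complete (s ∷ ss) (there x∈ss) = from (∈ᵇ-∪ x) (inj₂ (complete ss x∈ss))

  ⟦⟧-∩≡∅⇒disjoint : ∀ s t → ⟦ s ⟧ ∩ ⟦ t ⟧ ≡ ∅ → VertexDisjoint Adj s t
  ⟦⟧-∩≡∅⇒disjoint s t s∩t≡∅ x x∈s x∈t =
    ∉ᵇ-∅ x (subst (λ A → T (x ∈ᵇ A)) s∩t≡∅ (from (∈ᵇ-∩ x) (from (∈ᵇ-⟦⟧ x s) x∈s , from (∈ᵇ-⟦⟧ x t) x∈t)))

module _ {V : Set} {Adj : V → V → Set} {F : Family Adj} where

  walk-source-survives : ∀ {u v k} → WalkAvoid Adj F u v k → ¬ Removed Adj F u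
  walk-source-survives (here alive)     = alive
  walk-source-survives (step alive _ _) = alive

  walk-stays-in : (C : V → Set) → (∀ {w w′} → C w → Adj w w′ → ¬ Removed Adj F w′ → C w′) →
                  ∀ {u v k} → C u → WalkAvoid Adj F u v k → C v
  walk-stays-in C closed u∈C (here _)          = u∈C
  walk-stays-in C closed u∈C (step _ adj walk) =
    walk-stays-in C closed (closed u∈C adj (walk-source-survives walk)) walk

module _ (R : VSet n) where

  -- A separate function, so that evaluation shares the previous ball instead of recomputing it.
  grow : VSet n → VSet n
  grow S = S ∪ (neighbours S ∖ R)

  ball : QV n → ℕ → VSet n
  ball v zero    = ⁅ v ⁆
  ball v (suc k) = grow (ball v k)

diameter≤ᵇ : VSet n → ℕ → Bool
diameter≤ᵇ R d = all (λ v → v ∈ᵇ R ∨ isFull (R ∪ ball R v d)) vertices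

diameterAfterRemoving≤ᵇ : ℕ → List (Q1Sub (QAdj {n})) → Bool
diameterAfterRemoving≤ᵇ d ss = diameter≤ᵇ (⋃ ss) d

module _ (F : Family (QAdj {n})) where

  ball-sound : ∀ {v} → ¬ Removed QAdj F v → ∀ k u → T (u ∈ᵇ ball (⋃ (subs F)) v k) →
               ∃[ j ] j ≤ k × WalkAvoid QAdj F u v j
  ball-sound v-alive zero u h with to (∈ᵇ-⁅⁆ u _) h
  ... | refl = zero , z≤n , here v-alive
  ball-sound v-alive (suc k) u h with to (∈ᵇ-∪ u) h
  ... | inj₁ old = let j , j≤k , walk = ball-sound v-alive k u old in j , m≤n⇒m≤1+n j≤k , walk
  ... | inj₂ new with ∈ᵇ-∖ u new
  ... | adjacent , u∉R with ∈ᵇ-neighbours u _ adjacent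
  ... | i , near with ball-sound v-alive k (flip i u) near
  ... | j , j≤k , walk =
    suc j , s≤s j≤k , step (u∉R ∘ from (∈ᵇ-⋃ u (subs F))) (QAdj-flip i u) walk

  diameterAfterRemoving≤ᵇ-sound : ∀ d → T (diameterAfterRemoving≤ᵇ d (subs F)) → DiamAfterRemoval≤ QAdj F d
  diameterAfterRemoving≤ᵇ-sound d h u v u-alive v-alive with to T-∨ (T-all-vertices _ h v)
  ... | inj₁ v∈R = ⊥-elim (v-alive (to (∈ᵇ-⋃ v (subs F)) v∈R))
  ... | inj₂ full with to (∈ᵇ-∪ u) (T-all-vertices _ full u)
  ...   | inj₁ u∈R    = ⊥-elim (u-alive (to (∈ᵇ-⋃ u (subs F)) u∈R))
  ...   | inj₂ u∈ball = ball-sound v-alive d u u∈ball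

listsUpTo : ∀ {A : Set} → ℕ → List A → List (List A)
listsUpTo zero    xs = [] ∷ []
listsUpTo (suc k) xs = [] ∷ concatMap (λ x → map (x ∷_) (listsUpTo k xs)) xs

∈-listsUpTo : ∀ {A : Set} {xs ys : List A} k → All (_∈ xs) ys → length ys ≤ k → ys ∈ listsUpTo k xs
∈-listsUpTo zero    []              _             = here refl
∈-listsUpTo (suc k) []              _             = here refl
∈-listsUpTo (suc k) (y∈xs ∷ ys⊆xs) (s≤s |ys|≤k) =
  there (∈-concatMap⁺ _ (lose y∈xs (∈-map⁺ _ (∈-listsUpTo k ys⊆xs |ys|≤k))))

T-all-listsUpTo : ∀ {A : Set} (p : List A → Bool) k xs → all p (listsUpTo k xs) ≡ true →
                  ∀ {ys} → All (_∈ xs) ys → length ys ≤ k → T (p ys)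
T-all-listsUpTo p k xs all≡true ys⊆xs |ys|≤k =
  All.lookup (all⁺ p (listsUpTo k xs) (from T-≡ all≡true)) (∈-listsUpTo k ys⊆xs |ys|≤k)

edgeAlong : Fin n × QV n → Q1Sub (QAdj {n})
edgeAlong (i , u) = edgeSub u (flip i u) (QAdj-flip i u)

lowerEnds : ∀ n → List (Fin n × QV n)
lowerEnds n = filter (λ (i , u) → lookup u i ≟ false) (cartesianProduct (allFin n) vertices)

substructures : ∀ n → List (Q1Sub (QAdj {n}))
substructures n = map vertexSub vertices ++ map edgeAlong (lowerEnds n)

edgeAlong-∈ : ∀ i (u : QV n) → lookup u i ≡ false → edgeAlong (i , u) ∈ substructures n
edgeAlong-∈ i u low = ∈-++⁺ʳ _ (∈-map⁺ edgeAlong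
  (∈-filter⁺ (λ (i , u) → lookup u i ≟ false) (∈-cartesianProduct⁺ (∈-allFin i) (∈-vertices u)) low))

representative : (s : Q1Sub (QAdj {n})) → ∃[ s′ ] s′ ∈ substructures n × ⟦ s′ ⟧ ≡ ⟦ s ⟧
representative (vertexSub u) = vertexSub u , ∈-++⁺ˡ (∈-map⁺ vertexSub (∈-vertices u)) , refl
representative (edgeSub u w adj) with QAdj⇒flip u w adj
... | i , refl with lookup u i in low
...   | false = edgeAlong (i , u) , edgeAlong-∈ i u low , refl
...   | true  = edgeAlong (i , flip i u) , edgeAlong-∈ i (flip i u) (trans (lookup∘updateAt i u) (cong not low)) , reversed
  where
  reversed : ⁅ flip i u ⁆ ∪ ⁅ flip i (flip i u) ⁆ ≡ ⁅ u ⁆ ∪ ⁅ flip i u ⁆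
  reversed = trans (cong (λ w → ⁅ flip i u ⁆ ∪ ⁅ w ⁆) (flip-involutive i u)) (∪-comm _ _)

representatives : (ss : List (Q1Sub (QAdj {n}))) →
  ∃[ ss′ ] All (_∈ substructures n) ss′ × length ss′ ≡ length ss × ⋃ ss′ ≡ ⋃ ss
representatives []       = [] , [] , refl , refl
representatives (s ∷ ss) =
  let s′ , s′∈ , ⟦s′⟧≡⟦s⟧ = representative s
      ss′ , ss′⊆ , |ss′|≡|ss| , ⋃ss′≡⋃ss = representatives ss
  in s′ ∷ ss′ , s′∈ ∷ ss′⊆ , cong suc |ss′|≡|ss| , cong₂ _∪_ ⟦s′⟧≡⟦s⟧ ⋃ss′≡⋃ss

removing-two-checked : all (diameterAfterRemoving≤ᵇ 5) (listsUpTo 2 (substructures 4)) ≡ true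
removing-two-checked = refl

diameter≤5-after-removing-two : (ss : List (Q1Sub (QAdj {4}))) → length ss ≤ 2 → T (diameterAfterRemoving≤ᵇ 5 ss)
diameter≤5-after-removing-two ss |ss|≤2 =
  let ss′ , ss′⊆ , |ss′|≡|ss| , ⋃ss′≡⋃ss = representatives ss
  in subst (λ R → T (diameter≤ᵇ R 5)) ⋃ss′≡⋃ss
       (T-all-listsUpTo (diameterAfterRemoving≤ᵇ 5) 2 (substructures 4) removing-two-checked
         ss′⊆ (subst (_≤ 2) (sym |ss′|≡|ss|) |ss|≤2))

o 𝟙 : QV 4
o = false ∷ false ∷ false ∷ false ∷ []
𝟙 = true ∷ true ∷ true ∷ true ∷ []

spoke : Fin 4 → Q1Sub (QAdj {4})
spoke j = edgeSub (flip j o) (flip zero (flip j o)) (QAdj-flip zero (flip j o))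

isolating : Family (QAdj {4})
isolating = record
  { subs     = spoke j₁ ∷ spoke j₂ ∷ spoke j₃ ∷ []
  ; disjoint = (⟦⟧-∩≡∅⇒disjoint (spoke j₁) (spoke j₂) refl ∷ ⟦⟧-∩≡∅⇒disjoint (spoke j₁) (spoke j₃) refl ∷ [])
             ∷ (⟦⟧-∩≡∅⇒disjoint (spoke j₂) (spoke j₃) refl ∷ [])
             ∷ []
             ∷ []
  }
  where
  j₁ j₂ j₃ : Fin 4
  j₁ = suc zero
  j₂ = suc (suc zero)
  j₃ = suc (suc (suc zero))

data OnEdge₀ : QV 4 → Set where
  origin : OnEdge₀ o
  e₀     : OnEdge₀ (flip zero o)

flip-within : ∀ {w} → OnEdge₀ w → (i : Fin 4) → ¬ Removed QAdj isolating (flip i w) → OnEdge₀ (flip i w)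
flip-within origin zero                   _     = e₀
flip-within e₀     zero                   _     = origin
flip-within origin (suc zero)             alive = ⊥-elim (alive (here (inj₁ refl)))
flip-within origin (suc (suc zero))       alive = ⊥-elim (alive (there (here (inj₁ refl))))
flip-within origin (suc (suc (suc zero))) alive = ⊥-elim (alive (there (there (here (inj₁ refl)))))
flip-within e₀     (suc zero)             alive = ⊥-elim (alive (here (inj₂ refl)))
flip-within e₀     (suc (suc zero))       alive = ⊥-elim (alive (there (here (inj₂ refl))))
flip-within e₀     (suc (suc (suc zero))) alive = ⊥-elim (alive (there (there (here (inj₂ refl)))))

OnEdge₀-closed : ∀ {w w′} → OnEdge₀ w → QAdj w w′ → ¬ Removed QAdj isolating w′ → OnEdge₀ w′
OnEdge₀-closed {w} {w′} w∈ adj alive with QAdj⇒flip w w′ adj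
... | i , refl = flip-within w∈ i alive

isolating-disconnects : Disconnects QAdj isolating
isolating-disconnects =
  o , 𝟙 , from (∈ᵇ-⋃ o _) , from (∈ᵇ-⋃ 𝟙 _) , λ _ walk → 𝟙∉Edge₀ (walk-stays-in OnEdge₀ OnEdge₀-closed origin walk)
  where
  𝟙∉Edge₀ : ¬ OnEdge₀ 𝟙
  𝟙∉Edge₀ ()

lemma3p4 : DsfQ1≤ (QAdj {4}) 5
lemma3p4 κ (_ , κ-minimal) F |F|≤κ∸1 =
  diameterAfterRemoving≤ᵇ-sound F 5 (diameter≤5-after-removing-two (subs F) |F|≤2)
  where
  |F|≤2 : size QAdj F ≤ 2
  |F|≤2 = ≤-trans |F|≤κ∸1 (∸-monoˡ-≤ 1 (κ-minimal isolating isolating-disconnects))
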